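{- Let $G$ be a graph of order $n$ with maximum degree $\Delta$ and with $s'$ strong support vertices. Then $\gamma_{cI}(G)\geq \frac{2(n+s')}{\Delta+2}$, and this bound is sharp.
   Context: All graphs are finite and simple. A support vertex is a vertex adjacent to a leaf (vertex of degree one); it is strong if it is adjacent to more than one leaf. A function $f:V(G)\to\{0,1,2\}$ is a covering Italian dominating function (CID function) of $G$ if (i) for every vertex $v$ with $f(v)=0$ we have $\sum_{u\in N(v)} f(u)\geq 2$, where $N(v)$ is the open neighborhood of $v$, and (ii) the set $\{v: f(v)=0\}$ is independent. $\gamma_{cI}(G)$ is the minimum of $\sum_v f(v)$ over all CID functions $f$ of $G$. -}

module Defs where

open import Data.Nat using (ℕ; zero; suc; _+_; _*_; _≤_; _⊔_; _≡ᵇ_; _≤ᵇ_)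
open import Data.Bool using (Bool; true; false; if_then_else_; _∧_)
open import Data.Fin using (Fin; zero; suc)
open import Data.Product using (Σ; _×_; _,_)
open import Data.Empty using (⊥)
open import Relation.Binary.PropositionalEquality using (_≡_)

record Graph (n : ℕ) : Set where
  field
    adj    : Fin n → Fin n → Bool
    sym    : ∀ u v → adj u v ≡ adj v u
    irrefl : ∀ v → adj v v ≡ false
open Graph public

sumF : ∀ {n} → (Fin n → ℕ) → ℕ
sumF {zero}  f = 0
sumF {suc n} f = f zero + sumF (λ i → f (suc i))

maxF : ∀ {n} → (Fin n → ℕ) → ℕ
maxF {zero}  f = 0
maxF {suc n} f = f zero ⊔ maxF (λ i → f (suc i))

countF : ∀ {n} → (Fin n → Bool) → ℕ
countF p = sumF (λ i → if p i then 1 else 0)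

module _ {n : ℕ} (G : Graph n) where

  deg : Fin n → ℕ
  deg v = countF (adj G v)

  maxDeg : ℕ
  maxDeg = maxF deg

  isLeaf : Fin n → Bool
  isLeaf v = deg v ≡ᵇ 1

  leafNbrs : Fin n → ℕ
  leafNbrs v = countF (λ u → adj G v u ∧ isLeaf u)

  isStrongSupport : Fin n → Bool
  isStrongSupport v = 2 ≤ᵇ leafNbrs v

  strongSupportCount : ℕ
  strongSupportCount = countF isStrongSupport

  nbrSum : (Fin n → ℕ) → Fin n → ℕ
  nbrSum f v = sumF (λ u → if adj G v u then f u else 0)

  record IsCID (f : Fin n → ℕ) : Set where
    field
      range       : ∀ v → f v ≤ 2
      dominated   : ∀ v → f v ≡ 0 → 2 ≤ nbrSum f v
      independent : ∀ u v → adj G u v ≡ true → f u ≡ 0 → f v ≡ 0 → ⊥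

  weight : (Fin n → ℕ) → ℕ
  weight f = sumF f

  IsGammaCI : ℕ → Set
  IsGammaCI k = Σ (Fin n → ℕ) (λ f → IsCID f × weight f ≡ k)
              × (∀ f → IsCID f → k ≤ weight f)

-- Discharging.  Give every vertex the demand 2, or 4 if it is a strong support
-- vertex; the total demand is 2(n + s′).  A vertex v with f(v) > 0 covers its own
-- demand, and a vertex v with f(v) = 0 is paid f(u) by each neighbour u, plus one
-- more unit when u is a leaf and Δ ≥ 2 (automatic when s′ > 0): domination, and for
-- a strong support vertex also its two leaves, cover its demand.  The zeros being
-- independent, a zero pays nothing, and u with f(u) ≥ 1 pays at most f(u)(Δ + 2):
-- it has at most deg(u) ≤ Δ zero neighbours, and when f(u) = 1 none of them is a
-- leaf (a zero leaf next to u would only see f(u) = 1), so its zero and its leaf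
-- neighbours together fit into deg(u).  Hence 2(n + s′) ≤ w(f)(Δ + 2).  Disjoint
-- copies of K_{2,Δ}, with 1 on the two vertices of degree Δ, attain the bound.

module Submission where

open import Defs hiding (sym)
open import Data.Nat using (ℕ; zero; suc; _+_; _*_; _≤_; _<_; _≡ᵇ_; _≤ᵇ_; z≤n; s≤s; z<s; _≤?_; >-nonZero)
open import Data.Nat.Properties
open import Data.Bool using (Bool; true; false; if_then_else_; _∧_; _xor_; T)
open import Data.Bool.Properties using (T-≡; ∧-identityʳ; ∧-zeroʳ; xor-comm; xor-same)
open import Data.Fin using (Fin; zero; suc; _↑ˡ_; _↑ʳ_; splitAt)
open import Data.Fin.Properties using (splitAt-↑ˡ; splitAt-↑ʳ; splitAt⁻¹-↑ˡ; splitAt⁻¹-↑ʳ)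
open import Data.Vec.Functional using (_++_)
open import Data.Vec.Functional.Properties using (lookup-++ˡ; lookup-++ʳ)
open import Data.Sum using (_⊎_; inj₁; inj₂)
open import Data.Product using (Σ; _×_; _,_; proj₁; proj₂)
open import Data.Empty using (⊥; ⊥-elim)
open import Function using (_∘_; Equivalence)
open import Relation.Nullary using (yes; no)
open import Relation.Binary.PropositionalEquality
open import Algebra.Properties.Semiring.Sum +-*-semiring
  using (sum; ∑-distrib-+; ∑-comm; *-distribˡ-sum; *-distribʳ-sum)

-- Finite sums

𝟙 : Bool → ℕ
𝟙 b = if b then 1 else 0

𝟙≤1 : ∀ b → 𝟙 b ≤ 1
𝟙≤1 true  = ≤-refl
𝟙≤1 false = z≤n

if-then-0≡*𝟙 : ∀ b x → (if b then x else 0) ≡ x * 𝟙 b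
if-then-0≡*𝟙 true  x = sym (*-identityʳ x)
if-then-0≡*𝟙 false x = sym (*-zeroʳ x)

≡true⇒T : ∀ {b} → b ≡ true → T b
≡true⇒T = Equivalence.from T-≡

∧≡true⇒ˡ : ∀ {x y} → x ∧ y ≡ true → x ≡ true
∧≡true⇒ˡ {true} _ = refl

sumF≡sum : ∀ {n} (f : Fin n → ℕ) → sumF f ≡ sum f
sumF≡sum {zero}  f = refl
sumF≡sum {suc n} f = cong (f zero +_) (sumF≡sum (λ i → f (suc i)))

sumF-cong : ∀ {n} {f g : Fin n → ℕ} → (∀ i → f i ≡ g i) → sumF f ≡ sumF g
sumF-cong {zero}  h = refl
sumF-cong {suc n} h = cong₂ _+_ (h zero) (sumF-cong (λ i → h (suc i)))

sumF-mono : ∀ {n} {f g : Fin n → ℕ} → (∀ i → f i ≤ g i) → sumF f ≤ sumF g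
sumF-mono {zero}  h = z≤n
sumF-mono {suc n} h = +-mono-≤ (h zero) (sumF-mono (λ i → h (suc i)))

sumF-const : ∀ n c → sumF {n} (λ _ → c) ≡ n * c
sumF-const zero    c = refl
sumF-const (suc n) c = cong (c +_) (sumF-const n c)

sumF-zero : ∀ n → sumF {n} (λ _ → 0) ≡ 0
sumF-zero n = trans (sumF-const n 0) (*-zeroʳ n)

sumF-+ : ∀ {n} (f g : Fin n → ℕ) → sumF (λ i → f i + g i) ≡ sumF f + sumF g
sumF-+ f g = begin
  sumF (λ i → f i + g i)  ≡⟨ sumF≡sum (λ i → f i + g i) ⟩
  sum (λ i → f i + g i)   ≡⟨ ∑-distrib-+ f g ⟩
  sum f + sum g           ≡⟨ sym (cong₂ _+_ (sumF≡sum f) (sumF≡sum g)) ⟩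
  sumF f + sumF g         ∎
  where open ≡-Reasoning

sumF-*ˡ : ∀ {n} c (f : Fin n → ℕ) → sumF (λ i → c * f i) ≡ c * sumF f
sumF-*ˡ c f = trans (sumF≡sum (λ i → c * f i))
  (trans (sym (*-distribˡ-sum c f)) (cong (c *_) (sym (sumF≡sum f))))

sumF-*ʳ : ∀ {n} c (f : Fin n → ℕ) → sumF (λ i → f i * c) ≡ sumF f * c
sumF-*ʳ c f = trans (sumF≡sum (λ i → f i * c))
  (trans (sym (*-distribʳ-sum c f)) (cong (_* c) (sym (sumF≡sum f))))

sumF-comm : ∀ {m n} (g : Fin m → Fin n → ℕ) →
            sumF (λ i → sumF (g i)) ≡ sumF (λ j → sumF (λ i → g i j))
sumF-comm g = begin
  sumF (λ i → sumF (g i))          ≡⟨ sumF-cong (λ i → sumF≡sum (g i)) ⟩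
  sumF (λ i → sum (g i))           ≡⟨ sumF≡sum (λ i → sum (g i)) ⟩
  sum (λ i → sum (g i))            ≡⟨ ∑-comm g ⟩
  sum (λ j → sum (λ i → g i j))    ≡⟨ sumF≡sum (λ j → sum (λ i → g i j)) ⟨
  sumF (λ j → sum (λ i → g i j))   ≡⟨ sumF-cong (λ j → sumF≡sum (λ i → g i j)) ⟨
  sumF (λ j → sumF (λ i → g i j))  ∎
  where open ≡-Reasoning

sumF-split : ∀ a {b} (h : Fin (a + b) → ℕ) →
             sumF h ≡ sumF (λ x → h (x ↑ˡ b)) + sumF (λ y → h (a ↑ʳ y))
sumF-split zero    h = refl
sumF-split (suc a) h = trans (cong (h zero +_) (sumF-split a (λ i → h (suc i)))) (sym (+-assoc (h zero) _ _))

if-sumF : ∀ {n} b (h : Fin n → ℕ) → (if b then sumF h else 0) ≡ sumF (λ i → if b then h i else 0)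
if-sumF true  h = refl
if-sumF {n} false h = sym (sumF-zero n)

countF-mono : ∀ {n} {p q : Fin n → Bool} → (∀ i → p i ≡ true → q i ≡ true) → countF p ≤ countF q
countF-mono {p = p} {q} h = sumF-mono pointwise
  where
  pointwise : ∀ i → 𝟙 (p i) ≤ 𝟙 (q i)
  pointwise i with p i in e
  ... | false = z≤n
  ... | true  = ≤-reflexive (cong 𝟙 (sym (h i e)))

countF-false : ∀ {n} {p : Fin n → Bool} → (∀ i → p i ≡ false) → countF p ≡ 0
countF-false {n} h = trans (sumF-cong (λ i → cong 𝟙 (h i))) (sumF-zero n)

countF-pos : ∀ {n} (p : Fin n → Bool) {u} → p u ≡ true → 1 ≤ countF p
countF-pos p {zero}  e rewrite e = s≤s z≤n
countF-pos p {suc u} e = ≤-trans (countF-pos (λ i → p (suc i)) e) (m≤n+m _ (𝟙 (p zero)))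

sumF-if≡0 : ∀ {n} (p : Fin n → Bool) (g : Fin n → ℕ) → countF p ≡ 0 →
            sumF (λ i → if p i then g i else 0) ≡ 0
sumF-if≡0 {zero}  p g _ = refl
sumF-if≡0 {suc n} p g c with p zero
... | false = sumF-if≡0 (λ i → p (suc i)) (λ i → g (suc i)) c

sumF-if-single : ∀ {n} (p : Fin n → Bool) (g : Fin n → ℕ) {u} → countF p ≡ 1 → p u ≡ true →
                 sumF (λ i → if p i then g i else 0) ≡ g u
sumF-if-single p g {zero} c e with p zero
... | true = trans (cong (g zero +_) (sumF-if≡0 (λ i → p (suc i)) (λ i → g (suc i)) (suc-injective c)))
                  (+-identityʳ _)
sumF-if-single p g {suc u} c e with p zero
... | true  = ⊥-elim (1+n≰n (≤-trans (s≤s (countF-pos (λ i → p (suc i)) e)) (≤-reflexive c)))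
... | false = sumF-if-single (λ i → p (suc i)) (λ i → g (suc i)) c e

maxF-ub : ∀ {n} (f : Fin n → ℕ) i → f i ≤ maxF f
maxF-ub f zero    = m≤m⊔n _ _
maxF-ub f (suc i) = ≤-trans (maxF-ub (λ j → f (suc j)) i) (m≤n⊔m (f zero) _)

maxF-lub : ∀ {n} (f : Fin n → ℕ) {c} → (∀ i → f i ≤ c) → maxF f ≤ c
maxF-lub {zero}  f h = z≤n
maxF-lub {suc n} f h = ⊔-lub (h zero) (maxF-lub (λ i → f (suc i)) (λ i → h (suc i)))

maxF-attained : ∀ {n} (f : Fin n → ℕ) {c} i → (∀ j → f j ≤ c) → f i ≡ c → maxF f ≡ c
maxF-attained f i ub e = ≤-antisym (maxF-lub f ub) (≤-trans (≤-reflexive (sym e)) (maxF-ub f i))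

-- Degrees, leaves and neighbourhood sums

module _ {n : ℕ} (G : Graph n) where

  deg≤maxDeg : ∀ v → deg G v ≤ maxDeg G
  deg≤maxDeg = maxF-ub (deg G)

  leaf⇒deg≡1 : ∀ {v} → isLeaf G v ≡ true → deg G v ≡ 1
  leaf⇒deg≡1 e = ≡ᵇ⇒≡ _ 1 (≡true⇒T e)

  leafNbrs≤deg : ∀ v → leafNbrs G v ≤ deg G v
  leafNbrs≤deg v = countF-mono {n} (λ _ → ∧≡true⇒ˡ)

  2*𝟙strongSupport≤leafNbrs : ∀ v → 2 * 𝟙 (isStrongSupport G v) ≤ leafNbrs G v
  2*𝟙strongSupport≤leafNbrs v with isStrongSupport G v in e
  ... | false = z≤n
  ... | true  = ≤ᵇ⇒≤ 2 _ (≡true⇒T e)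

  strongSupport⇒2≤maxDeg : ∀ {v} → isStrongSupport G v ≡ true → 2 ≤ maxDeg G
  strongSupport⇒2≤maxDeg {v} e =
    ≤-trans (≤ᵇ⇒≤ 2 _ (≡true⇒T e)) (≤-trans (leafNbrs≤deg v) (deg≤maxDeg v))

  leaf⇒¬strongSupport : ∀ {v} → isLeaf G v ≡ true → isStrongSupport G v ≡ false
  leaf⇒¬strongSupport {v} l with isStrongSupport G v in e
  ... | false = refl
  ... | true  = ⊥-elim (1+n≰n (begin
    2            ≤⟨ ≤ᵇ⇒≤ 2 _ (≡true⇒T e) ⟩
    leafNbrs G v ≤⟨ leafNbrs≤deg v ⟩
    deg G v      ≡⟨ leaf⇒deg≡1 l ⟩
    1            ∎))
    where open ≤-Reasoning

  strongSupportCount≡0 : (∀ v → 2 ≤ deg G v) → strongSupportCount G ≡ 0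
  strongSupportCount≡0 2≤deg = countF-false (λ v → cong (2 ≤ᵇ_) (leafNbrs≡0 v))
    where
    notLeaf : ∀ {d} → 2 ≤ d → (d ≡ᵇ 1) ≡ false
    notLeaf (s≤s (s≤s _)) = refl
    leafNbrs≡0 : ∀ v → leafNbrs G v ≡ 0
    leafNbrs≡0 v = countF-false (λ w → trans (cong (adj G v w ∧_) (notLeaf (2≤deg w))) (∧-zeroʳ _))

  maxDeg≡ : ∀ {Δ} v → (∀ w → deg G w ≤ Δ) → deg G v ≡ Δ → maxDeg G ≡ Δ
  maxDeg≡ = maxF-attained (deg G)

  nbrSum-cong : ∀ {g h : Fin n → ℕ} → (∀ u → g u ≡ h u) → ∀ v → nbrSum G g v ≡ nbrSum G h v
  nbrSum-cong g≗h v = sumF-cong (λ u → cong (if adj G v u then_else 0) (g≗h u))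

  nbrSum-mono : ∀ {g h : Fin n → ℕ} → (∀ u → g u ≤ h u) → ∀ v → nbrSum G g v ≤ nbrSum G h v
  nbrSum-mono {g} {h} g≤h v = sumF-mono pointwise
    where
    pointwise : ∀ u → (if adj G v u then g u else 0) ≤ (if adj G v u then h u else 0)
    pointwise u with adj G v u
    ... | true  = g≤h u
    ... | false = z≤n

  nbrSum-+ : ∀ (g h : Fin n → ℕ) v → nbrSum G (λ u → g u + h u) v ≡ nbrSum G g v + nbrSum G h v
  nbrSum-+ g h v = trans (sumF-cong pointwise) (sumF-+ {n} _ _)
    where
    pointwise : ∀ u → (if adj G v u then g u + h u else 0)
                    ≡ (if adj G v u then g u else 0) + (if adj G v u then h u else 0)
    pointwise u with adj G v u
    ... | true  = refl
    ... | false = refl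

  nbrSum-𝟙leaf : ∀ v → nbrSum G (𝟙 ∘ isLeaf G) v ≡ leafNbrs G v
  nbrSum-𝟙leaf v = sumF-cong pointwise
    where
    pointwise : ∀ u → (if adj G v u then 𝟙 (isLeaf G u) else 0) ≡ 𝟙 (adj G v u ∧ isLeaf G u)
    pointwise u with adj G v u
    ... | true  = refl
    ... | false = refl

  nbrSum-leaf : ∀ {w u} (f : Fin n → ℕ) → isLeaf G w ≡ true → adj G w u ≡ true → nbrSum G f w ≡ f u
  nbrSum-leaf f l a = sumF-if-single _ f (leaf⇒deg≡1 l) a

  sumF-nbrSum : ∀ (p : Fin n → Bool) (g : Fin n → ℕ) →
                sumF (λ v → if p v then nbrSum G g v else 0)
                ≡ sumF (λ u → g u * countF (λ v → adj G u v ∧ p v))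
  sumF-nbrSum p g = begin
    sumF (λ v → if p v then nbrSum G g v else 0)
      ≡⟨ sumF-cong (λ v → if-sumF {n} (p v) _) ⟩
    sumF (λ v → sumF (λ u → if p v then (if adj G v u then g u else 0) else 0))
      ≡⟨ sumF-comm {n} {n} _ ⟩
    sumF (λ u → sumF (λ v → if p v then (if adj G v u then g u else 0) else 0))
      ≡⟨ sumF-cong (λ u → sumF-cong (term u)) ⟩
    sumF (λ u → sumF (λ v → g u * 𝟙 (adj G u v ∧ p v)))
      ≡⟨ sumF-cong (λ u → sumF-*ˡ {n} (g u) _) ⟩
    sumF (λ u → g u * countF (λ v → adj G u v ∧ p v))
      ∎
    where
    open ≡-Reasoning
    term : ∀ u v → (if p v then (if adj G v u then g u else 0) else 0) ≡ g u * 𝟙 (adj G u v ∧ p v)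
    term u v rewrite Graph.sym G v u with p v
    ... | true  = trans (if-then-0≡*𝟙 _ (g u)) (cong (λ b → g u * 𝟙 b) (sym (∧-identityʳ _)))
    ... | false = trans (if-then-0≡*𝟙 false (g u)) (cong (λ b → g u * 𝟙 b) (sym (∧-zeroʳ _)))

-- The lower bound

isZero : ∀ {n} → (Fin n → ℕ) → Fin n → Bool
isZero f v = f v ≡ᵇ 0

≡ᵇ0⇒≡0 : ∀ m → (m ≡ᵇ 0) ≡ true → m ≡ 0
≡ᵇ0⇒≡0 m e = ≡ᵇ⇒≡ m 0 (≡true⇒T e)

≢ᵇ0⇒>0 : ∀ m → (m ≡ᵇ 0) ≡ false → 0 < m
≢ᵇ0⇒>0 (suc _) _ = s≤s z≤n

zeroNbrs : ∀ {n} → Graph n → (Fin n → ℕ) → Fin n → ℕ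
zeroNbrs G f u = countF (λ w → adj G u w ∧ isZero f w)

module _ {n : ℕ} {G : Graph n} {f : Fin n → ℕ} (cid : IsCID G f) where
  open IsCID cid

  zeroNbrs≤deg : ∀ u → zeroNbrs G f u ≤ deg G u
  zeroNbrs≤deg u = countF-mono {n} (λ _ → ∧≡true⇒ˡ)

  zeroNbrs≡0 : ∀ {u} → f u ≡ 0 → zeroNbrs G f u ≡ 0
  zeroNbrs≡0 {u} fu≡0 = countF-false pointwise
    where
    pointwise : ∀ w → (adj G u w ∧ isZero f w) ≡ false
    pointwise w with adj G u w in a | isZero f w in z
    ... | true  | true  = ⊥-elim (independent u w a fu≡0 (≡ᵇ0⇒≡0 (f w) z))
    ... | true  | false = refl
    ... | false | _     = refl

  zeroNbrs+leafNbrs≤deg : ∀ {u} → f u ≤ 1 → zeroNbrs G f u + leafNbrs G u ≤ deg G u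
  zeroNbrs+leafNbrs≤deg {u} fu≤1 = ≤-trans (≤-reflexive (sym (sumF-+ {n} _ _))) (sumF-mono pointwise)
    where
    pointwise : ∀ w → 𝟙 (adj G u w ∧ isZero f w) + 𝟙 (adj G u w ∧ isLeaf G w) ≤ 𝟙 (adj G u w)
    pointwise w with adj G u w in a | isZero f w in z | isLeaf G w in l
    ... | false | _     | _     = z≤n
    ... | true  | false | _     = 𝟙≤1 _
    ... | true  | true  | false = ≤-refl
    ... | true  | true  | true  = ⊥-elim (1+n≰n (begin
      2              ≤⟨ dominated w (≡ᵇ0⇒≡0 (f w) z) ⟩
      nbrSum G f w   ≡⟨ nbrSum-leaf G f l (trans (Graph.sym G w u) a) ⟩
      f u            ≤⟨ fu≤1 ⟩
      1              ∎))
      where open ≤-Reasoning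

𝟙+2≤Δ+1 : ∀ b {Δ} → 1 ≤ Δ → (b ≡ true → 2 ≤ Δ) → 𝟙 b + 2 ≤ Δ + 1
𝟙+2≤Δ+1 false 1≤Δ _   = +-monoˡ-≤ 1 1≤Δ
𝟙+2≤Δ+1 true  _   2≤Δ = +-monoˡ-≤ 1 (2≤Δ refl)

sent≤-leaf : ∀ {k d x Δ} → 1 ≤ k → d ≤ 1 → x + 2 ≤ Δ + 1 → (k + x) * d + 2 ≤ k * (Δ + 2)
sent≤-leaf {k} {d} {x} {Δ} 1≤k d≤1 x+2≤Δ+1 = begin
  (k + x) * d + 2   ≤⟨ +-monoˡ-≤ 2 (*-monoʳ-≤ (k + x) d≤1) ⟩
  (k + x) * 1 + 2   ≡⟨ cong (_+ 2) (*-identityʳ (k + x)) ⟩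
  k + x + 2         ≡⟨ +-assoc k x 2 ⟩
  k + (x + 2)       ≤⟨ +-monoʳ-≤ k x+2≤Δ+1 ⟩
  k + (Δ + 1)       ≤⟨ +-monoʳ-≤ k (m≤n*m (Δ + 1) k {{>-nonZero 1≤k}}) ⟩
  k + k * (Δ + 1)   ≡⟨ sym (*-suc k (Δ + 1)) ⟩
  k * suc (Δ + 1)   ≡⟨ cong (k *_) (sym (+-suc Δ 1)) ⟩
  k * (Δ + 2)       ∎
  where open ≤-Reasoning

sent≤-nonleaf : ∀ {k d x Δ} → 1 ≤ k → x ≤ 2 → d ≤ Δ → (k ≤ 1 → d + x ≤ Δ) →
               k * d + (2 + x) ≤ k * (Δ + 2)
sent≤-nonleaf {suc zero} {d} {x} {Δ} _ _ _ h = begin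
  1 * d + (2 + x)   ≡⟨ cong (_+ (2 + x)) (*-identityˡ d) ⟩
  d + (2 + x)       ≡⟨ cong (d +_) (+-comm 2 x) ⟩
  d + (x + 2)       ≡⟨ sym (+-assoc d x 2) ⟩
  d + x + 2         ≤⟨ +-monoˡ-≤ 2 (h ≤-refl) ⟩
  Δ + 2             ≡⟨ sym (*-identityˡ (Δ + 2)) ⟩
  1 * (Δ + 2)       ∎
  where open ≤-Reasoning
sent≤-nonleaf {k@(suc (suc j))} {d} {x} {Δ} _ x≤2 d≤Δ _ = begin
  k * d + (2 + x)   ≤⟨ +-monoʳ-≤ (k * d) (+-monoʳ-≤ 2 x≤2) ⟩
  k * d + 4         ≤⟨ +-monoʳ-≤ (k * d) (m≤m+n 4 (j * 2)) ⟩
  k * d + k * 2     ≡⟨ sym (*-distribˡ-+ k d 2) ⟩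
  k * (d + 2)       ≤⟨ *-monoʳ-≤ k (+-monoˡ-≤ 2 d≤Δ) ⟩
  k * (Δ + 2)       ∎
  where open ≤-Reasoning

module Discharging {n : ℕ} {G : Graph n} {f : Fin n → ℕ} (cid : IsCID G f) (bonus : Bool)
  (bonus⇒2≤Δ : bonus ≡ true → 2 ≤ maxDeg G)
  (strongSupport⇒bonus : ∀ {v} → isStrongSupport G v ≡ true → bonus ≡ true) where

  open IsCID cid

  Δ : ℕ
  Δ = maxDeg G

  demand : Fin n → ℕ
  demand v = 2 + 2 * 𝟙 (isStrongSupport G v)

  value : Fin n → ℕ
  value u = f u + 𝟙 (bonus ∧ isLeaf G u)

  received : Fin n → ℕ
  received v = if isZero f v then nbrSum G value v else demand v

  sent : Fin n → ℕ
  sent u = value u * zeroNbrs G f u + (if isZero f u then 0 else demand u)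

  demand≤received : ∀ v → demand v ≤ received v
  demand≤received v with isZero f v in z | isStrongSupport G v in s
  ... | false | _     = ≤-refl
  ... | true  | false = ≤-trans (dominated v (≡ᵇ0⇒≡0 (f v) z)) (nbrSum-mono G (λ u → m≤m+n (f u) _) v)
  ... | true  | true  = begin
    2 + 2                                   ≤⟨ +-mono-≤ (dominated v (≡ᵇ0⇒≡0 (f v) z))
                                                        (≤ᵇ⇒≤ 2 _ (≡true⇒T s)) ⟩
    nbrSum G f v + leafNbrs G v             ≡⟨ cong (nbrSum G f v +_) (sym (nbrSum-𝟙leaf G v)) ⟩
    nbrSum G f v + nbrSum G (𝟙 ∘ isLeaf G) v ≡⟨ sym (nbrSum-+ G f _ v) ⟩
    nbrSum G (λ u → f u + 𝟙 (isLeaf G u)) v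
      ≡⟨ nbrSum-cong G (λ u → cong (λ b → f u + 𝟙 (b ∧ isLeaf G u)) (sym (strongSupport⇒bonus s))) v ⟩
    nbrSum G value v                        ∎
    where open ≤-Reasoning

  sent≤ : ∀ u → sent u ≤ f u * (Δ + 2)
  sent≤ u with isZero f u in z
  ... | true = begin
    value u * zeroNbrs G f u + 0  ≡⟨ +-identityʳ _ ⟩
    value u * zeroNbrs G f u      ≡⟨ cong (value u *_) (zeroNbrs≡0 cid (≡ᵇ0⇒≡0 (f u) z)) ⟩
    value u * 0                   ≡⟨ *-zeroʳ (value u) ⟩
    0                             ≤⟨ z≤n ⟩
    f u * (Δ + 2)                 ∎
    where open ≤-Reasoning
  ... | false with isLeaf G u in l
  ...   | true rewrite leaf⇒¬strongSupport G l | ∧-identityʳ bonus =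
    sent≤-leaf (≢ᵇ0⇒>0 (f u) z)
      (≤-trans (zeroNbrs≤deg cid u) (≤-reflexive (leaf⇒deg≡1 G l)))
      (𝟙+2≤Δ+1 bonus (≤-trans (≤-reflexive (sym (leaf⇒deg≡1 G l))) (deg≤maxDeg G u)) bonus⇒2≤Δ)
  ...   | false rewrite ∧-zeroʳ bonus | +-identityʳ (f u) =
    sent≤-nonleaf (≢ᵇ0⇒>0 (f u) z) (*-monoʳ-≤ 2 (𝟙≤1 (isStrongSupport G u)))
      (≤-trans (zeroNbrs≤deg cid u) (deg≤maxDeg G u))
      (λ fu≤1 → begin
        zeroNbrs G f u + 2 * 𝟙 (isStrongSupport G u) ≤⟨ +-monoʳ-≤ _ (2*𝟙strongSupport≤leafNbrs G u) ⟩
        zeroNbrs G f u + leafNbrs G u                 ≤⟨ zeroNbrs+leafNbrs≤deg cid fu≤1 ⟩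
        deg G u                                       ≤⟨ deg≤maxDeg G u ⟩
        Δ                                             ∎)
    where open ≤-Reasoning

  sumF-received≡sumF-sent : sumF received ≡ sumF sent
  sumF-received≡sumF-sent = begin
    sumF received                                      ≡⟨ sumF-cong split ⟩
    sumF (λ v → (if isZero f v then nbrSum G value v else 0) + kept v)
                                                       ≡⟨ sumF-+ {n} _ kept ⟩
    sumF (λ v → if isZero f v then nbrSum G value v else 0) + sumF kept
                                                       ≡⟨ cong (_+ sumF kept) (sumF-nbrSum G (isZero f) value) ⟩
    sumF (λ u → value u * zeroNbrs G f u) + sumF kept  ≡⟨ sym (sumF-+ {n} _ kept) ⟩
    sumF sent                                          ∎
    where
    open ≡-Reasoning
    kept : Fin n → ℕ
    kept u = if isZero f u then 0 else demand u
    split : ∀ v → received v ≡ (if isZero f v then nbrSum G value v else 0) + kept v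
    split v with isZero f v
    ... | true  = sym (+-identityʳ _)
    ... | false = refl

  weight-bound : 2 * (n + strongSupportCount G) ≤ weight G f * (Δ + 2)
  weight-bound = begin
    2 * (n + strongSupportCount G)   ≡⟨ sumF-demand ⟩
    sumF demand                      ≤⟨ sumF-mono demand≤received ⟩
    sumF received                    ≡⟨ sumF-received≡sumF-sent ⟩
    sumF sent                        ≤⟨ sumF-mono sent≤ ⟩
    sumF (λ u → f u * (Δ + 2))       ≡⟨ sumF-*ʳ (Δ + 2) f ⟩
    weight G f * (Δ + 2)             ∎
    where
    open ≤-Reasoning
    sumF-demand : 2 * (n + strongSupportCount G) ≡ sumF demand
    sumF-demand = begin-equality
      2 * (n + strongSupportCount G)  ≡⟨ *-distribˡ-+ 2 n _ ⟩
      2 * n + 2 * strongSupportCount G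
        ≡⟨ cong₂ _+_ (trans (*-comm 2 n) (sym (sumF-const n 2))) (sym (sumF-*ˡ {n} 2 _)) ⟩
      sumF {n} (λ _ → 2) + sumF (λ v → 2 * 𝟙 (isStrongSupport G v))  ≡⟨ sym (sumF-+ {n} _ _) ⟩
      sumF demand                      ∎

IsCID⇒lowerBound : ∀ {n} (G : Graph n) {f : Fin n → ℕ} → IsCID G f →
                   2 * (n + strongSupportCount G) ≤ weight G f * (maxDeg G + 2)
IsCID⇒lowerBound G cid with 2 ≤? maxDeg G
... | yes 2≤Δ = Discharging.weight-bound cid true (λ _ → 2≤Δ) (λ _ → refl)
... | no  2≰Δ = Discharging.weight-bound cid false (λ ())
                  (λ s → ⊥-elim (2≰Δ (strongSupport⇒2≤maxDeg G s)))

IsGammaCI⇒lowerBound : ∀ {n} (G : Graph n) {k} → IsGammaCI G k →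
                       2 * (n + strongSupportCount G) ≤ k * (maxDeg G + 2)
IsGammaCI⇒lowerBound G ((f , cid , refl) , _) = IsCID⇒lowerBound G cid

tight⇒IsGammaCI : ∀ {n} (G : Graph n) {f : Fin n → ℕ} → IsCID G f →
                  2 * (n + strongSupportCount G) ≡ weight G f * (maxDeg G + 2) → IsGammaCI G (weight G f)
tight⇒IsGammaCI {n} G {f} cid tight = (f , cid , refl) , minimal
  where
  minimal : ∀ g → IsCID G g → weight G f ≤ weight G g
  minimal g cidg = *-cancelʳ-≤ (weight G f) (weight G g) (maxDeg G + 2)
    {{>-nonZero (<-≤-trans z<s (m≤n+m 2 (maxDeg G)))}}
    (subst (_≤ weight G g * (maxDeg G + 2)) tight (IsCID⇒lowerBound G cidg))

-- Disjoint unions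

↑-elim : ∀ {a b} {P : Fin (a + b) → Set} → (∀ x → P (x ↑ˡ b)) → (∀ y → P (a ↑ʳ y)) → ∀ i → P i
↑-elim {a} {P = P} l r i with splitAt a i in e
... | inj₁ x = subst P (splitAt⁻¹-↑ˡ e) (l x)
... | inj₂ y = subst P (splitAt⁻¹-↑ʳ e) (r y)

module _ {a b : ℕ} (G : Graph a) (H : Graph b) where

  private
    adj⊎ : Fin a ⊎ Fin b → Fin a ⊎ Fin b → Bool
    adj⊎ (inj₁ x) (inj₁ y) = adj G x y
    adj⊎ (inj₂ x) (inj₂ y) = adj H x y
    adj⊎ _        _        = false

    adj⊎-sym : ∀ p q → adj⊎ p q ≡ adj⊎ q p
    adj⊎-sym (inj₁ x) (inj₁ y) = Graph.sym G x y
    adj⊎-sym (inj₁ x) (inj₂ y) = refl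
    adj⊎-sym (inj₂ x) (inj₁ y) = refl
    adj⊎-sym (inj₂ x) (inj₂ y) = Graph.sym H x y

    adj⊎-irrefl : ∀ p → adj⊎ p p ≡ false
    adj⊎-irrefl (inj₁ x) = irrefl G x
    adj⊎-irrefl (inj₂ y) = irrefl H y

  _⊕_ : Graph (a + b)
  _⊕_ = record
    { adj    = λ i j → adj⊎ (splitAt a i) (splitAt a j)
    ; sym    = λ i j → adj⊎-sym (splitAt a i) (splitAt a j)
    ; irrefl = λ i → adj⊎-irrefl (splitAt a i)
    }

module _ {a b : ℕ} (G : Graph a) (H : Graph b) where

  adj-⊕-↑ˡ↑ˡ : ∀ x y → adj (G ⊕ H) (x ↑ˡ b) (y ↑ˡ b) ≡ adj G x y
  adj-⊕-↑ˡ↑ˡ x y rewrite splitAt-↑ˡ a x b | splitAt-↑ˡ a y b = refl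

  adj-⊕-↑ˡ↑ʳ : ∀ x y → adj (G ⊕ H) (x ↑ˡ b) (a ↑ʳ y) ≡ false
  adj-⊕-↑ˡ↑ʳ x y rewrite splitAt-↑ˡ a x b | splitAt-↑ʳ a b y = refl

  adj-⊕-↑ʳ↑ˡ : ∀ x y → adj (G ⊕ H) (a ↑ʳ x) (y ↑ˡ b) ≡ false
  adj-⊕-↑ʳ↑ˡ x y rewrite splitAt-↑ʳ a b x | splitAt-↑ˡ a y b = refl

  adj-⊕-↑ʳ↑ʳ : ∀ x y → adj (G ⊕ H) (a ↑ʳ x) (a ↑ʳ y) ≡ adj H x y
  adj-⊕-↑ʳ↑ʳ x y rewrite splitAt-↑ʳ a b x | splitAt-↑ʳ a b y = refl

  nbrSum-⊕-↑ˡ : ∀ (h : Fin (a + b) → ℕ) x →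
                nbrSum (G ⊕ H) h (x ↑ˡ b) ≡ nbrSum G (λ y → h (y ↑ˡ b)) x
  nbrSum-⊕-↑ˡ h x = trans (sumF-split a _) (trans (cong₂ _+_
    (sumF-cong (λ y → cong (if_then h (y ↑ˡ b) else 0) (adj-⊕-↑ˡ↑ˡ x y)))
    (trans (sumF-cong (λ y → cong (if_then h (a ↑ʳ y) else 0) (adj-⊕-↑ˡ↑ʳ x y))) (sumF-zero b)))
    (+-identityʳ _))

  nbrSum-⊕-↑ʳ : ∀ (h : Fin (a + b) → ℕ) y →
                nbrSum (G ⊕ H) h (a ↑ʳ y) ≡ nbrSum H (λ x → h (a ↑ʳ x)) y
  nbrSum-⊕-↑ʳ h y = trans (sumF-split a _) (cong₂ _+_
    (trans (sumF-cong (λ x → cong (if_then h (x ↑ˡ b) else 0) (adj-⊕-↑ʳ↑ˡ y x))) (sumF-zero a))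
    (sumF-cong (λ x → cong (if_then h (a ↑ʳ x) else 0) (adj-⊕-↑ʳ↑ʳ y x))))

  ⊕-deg : (P : ℕ → Set) → (∀ x → P (deg G x)) → (∀ y → P (deg H y)) → ∀ i → P (deg (G ⊕ H) i)
  ⊕-deg P PG PH = ↑-elim (λ x → subst P (sym (nbrSum-⊕-↑ˡ (λ _ → 1) x)) (PG x))
                         (λ y → subst P (sym (nbrSum-⊕-↑ʳ (λ _ → 1) y)) (PH y))

  weight-⊕ : ∀ (f : Fin a → ℕ) (g : Fin b → ℕ) → weight (G ⊕ H) (f ++ g) ≡ weight G f + weight H g
  weight-⊕ f g = trans (sumF-split a (f ++ g))
    (cong₂ _+_ (sumF-cong (lookup-++ˡ f g)) (sumF-cong (lookup-++ʳ f g)))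

  IsCID-⊕ : ∀ {f : Fin a → ℕ} {g : Fin b → ℕ} → IsCID G f → IsCID H g → IsCID (G ⊕ H) (f ++ g)
  IsCID-⊕ {f} {g} cf cg = record
    { range       = ↑-elim (λ x → subst (_≤ 2) (sym (lookup-++ˡ f g x)) (IsCID.range cf x))
                           (λ y → subst (_≤ 2) (sym (lookup-++ʳ f g y)) (IsCID.range cg y))
    ; dominated   = ↑-elim (λ x e → subst (2 ≤_) (sym (nbrSum-++ˡ x))
                                      (IsCID.dominated cf x (trans (sym (lookup-++ˡ f g x)) e)))
                           (λ y e → subst (2 ≤_) (sym (nbrSum-++ʳ y))
                                      (IsCID.dominated cg y (trans (sym (lookup-++ʳ f g y)) e)))
    ; independent = ↑-elim
        (λ x → ↑-elim
          (λ y e ex ey → IsCID.independent cf x y (trans (sym (adj-⊕-↑ˡ↑ˡ x y)) e)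
                           (trans (sym (lookup-++ˡ f g x)) ex) (trans (sym (lookup-++ˡ f g y)) ey))
          (λ y e _ _ → false≢true (trans (sym (adj-⊕-↑ˡ↑ʳ x y)) e)))
        (λ x → ↑-elim
          (λ y e _ _ → false≢true (trans (sym (adj-⊕-↑ʳ↑ˡ x y)) e))
          (λ y e ex ey → IsCID.independent cg x y (trans (sym (adj-⊕-↑ʳ↑ʳ x y)) e)
                           (trans (sym (lookup-++ʳ f g x)) ex) (trans (sym (lookup-++ʳ f g y)) ey)))
    }
    where
    false≢true : false ≡ true → ⊥
    false≢true ()
    nbrSum-++ˡ : ∀ x → nbrSum (G ⊕ H) (f ++ g) (x ↑ˡ b) ≡ nbrSum G f x
    nbrSum-++ˡ x = trans (nbrSum-⊕-↑ˡ (f ++ g) x) (nbrSum-cong G (lookup-++ˡ f g) x)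
    nbrSum-++ʳ : ∀ y → nbrSum (G ⊕ H) (f ++ g) (a ↑ʳ y) ≡ nbrSum H g y
    nbrSum-++ʳ y = trans (nbrSum-⊕-↑ʳ (f ++ g) y) (nbrSum-cong H (lookup-++ʳ f g) y)

emptyGraph : Graph 0
emptyGraph = record { adj = λ () ; sym = λ () ; irrefl = λ () }

copies : ∀ c {m} → Graph m → Graph (c * m)
copies zero    G = emptyGraph
copies (suc c) G = G ⊕ copies c G

copiesF : ∀ c {m} → (Fin m → ℕ) → Fin (c * m) → ℕ
copiesF zero    f ()
copiesF (suc c) f = f ++ copiesF c f

module _ {m : ℕ} (G : Graph m) where

  copies-deg : (P : ℕ → Set) → (∀ v → P (deg G v)) → ∀ c i → P (deg (copies c G) i)
  copies-deg P PG zero    ()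
  copies-deg P PG (suc c) = ⊕-deg G (copies c G) P PG (copies-deg P PG c)

  weight-copies : ∀ (f : Fin m → ℕ) c → weight (copies c G) (copiesF c f) ≡ c * weight G f
  weight-copies f zero    = refl
  weight-copies f (suc c) = trans (weight-⊕ G (copies c G) f (copiesF c f))
                                  (cong (weight G f +_) (weight-copies f c))

  IsCID-copies : ∀ {f : Fin m → ℕ} → IsCID G f → ∀ c → IsCID (copies c G) (copiesF c f)
  IsCID-copies cid zero    = record { range = λ () ; dominated = λ () ; independent = λ () }
  IsCID-copies cid (suc c) = IsCID-⊕ G (copies c G) cid (IsCID-copies cid c)

-- Sharpness

completeBipartite : ∀ {n} → (Fin n → Bool) → Graph n
completeBipartite side = record
  { adj    = λ u v → side u xor side v
  ; sym    = λ u v → xor-comm (side u) (side v)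
  ; irrefl = λ v → xor-same (side v)
  }

IsCID-completeBipartite : ∀ {n} (side : Fin n → Bool) → 2 ≤ countF side →
                          IsCID (completeBipartite side) (𝟙 ∘ side)
IsCID-completeBipartite side 2≤|side| = record
  { range       = λ v → ≤-trans (𝟙≤1 (side v)) (n≤1+n 1)
  ; dominated   = λ v e → subst (2 ≤_) (sym (nbrSum≡countF v e)) 2≤|side|
  ; independent = independent
  }
  where
  nbrSum≡countF : ∀ v → 𝟙 (side v) ≡ 0 → nbrSum (completeBipartite side) (𝟙 ∘ side) v ≡ countF side
  nbrSum≡countF v e = sumF-cong pointwise
    where
    pointwise : ∀ u → (if side v xor side u then 𝟙 (side u) else 0) ≡ 𝟙 (side u)
    pointwise u with side v | side u
    ... | false | false = refl
    ... | false | true  = refl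
  independent : ∀ u v → side u xor side v ≡ true → 𝟙 (side u) ≡ 0 → 𝟙 (side v) ≡ 0 → ⊥
  independent u v with side u | side v
  ... | false | false = λ ()

-- K₂ Δ is K_{2,Δ}; hub marks its part of size 2.
hub : ∀ {Δ} → Fin (2 + Δ) → Bool
hub zero          = true
hub (suc zero)    = true
hub (suc (suc _)) = false

K₂ : ∀ Δ → Graph (2 + Δ)
K₂ Δ = completeBipartite hub

deg-K₂-hub : ∀ Δ → deg (K₂ Δ) zero ≡ Δ
deg-K₂-hub Δ = trans (sumF-const Δ 1) (*-identityʳ Δ)

deg-K₂ : ∀ {Δ} → 2 ≤ Δ → ∀ v → 2 ≤ deg (K₂ Δ) v × deg (K₂ Δ) v ≤ Δ
deg-K₂ {Δ} 2≤Δ zero          = subst (λ d → 2 ≤ d × d ≤ Δ) (sym (deg-K₂-hub Δ)) (2≤Δ , ≤-refl)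
deg-K₂ {Δ} 2≤Δ (suc zero)    = subst (λ d → 2 ≤ d × d ≤ Δ) (sym (deg-K₂-hub Δ)) (2≤Δ , ≤-refl)
deg-K₂ {Δ} 2≤Δ (suc (suc _)) = subst (λ d → 2 ≤ d × d ≤ Δ) (sym (cong (2 +_) (sumF-zero Δ)))
                                     (≤-refl , subst (_≤ Δ) (sym (+-identityʳ 2)) 2≤Δ)

sharpGraph : ∀ Δ c → Graph (suc c * (2 + Δ))
sharpGraph Δ c = copies (suc c) (K₂ Δ)

sharpCID : ∀ Δ c → Fin (suc c * (2 + Δ)) → ℕ
sharpCID Δ c = copiesF (suc c) (𝟙 ∘ hub)

sharpCID-IsCID : ∀ Δ c → IsCID (sharpGraph Δ c) (sharpCID Δ c)
sharpCID-IsCID Δ c = IsCID-copies (K₂ Δ) (IsCID-completeBipartite hub (m≤m+n 2 _)) (suc c)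

sharpCID-weight : ∀ Δ c → weight (sharpGraph Δ c) (sharpCID Δ c) ≡ suc c * 2
sharpCID-weight Δ c = trans (weight-copies (K₂ Δ) (𝟙 ∘ hub) (suc c))
  (cong (λ w → suc c * (2 + w)) (sumF-zero Δ))

module _ {Δ : ℕ} (2≤Δ : 2 ≤ Δ) (c : ℕ) where

  sharpGraph-deg : ∀ v → 2 ≤ deg (sharpGraph Δ c) v × deg (sharpGraph Δ c) v ≤ Δ
  sharpGraph-deg = copies-deg (K₂ Δ) (λ d → 2 ≤ d × d ≤ Δ) (deg-K₂ 2≤Δ) (suc c)

  sharpGraph-maxDeg : maxDeg (sharpGraph Δ c) ≡ Δ
  sharpGraph-maxDeg = maxDeg≡ (sharpGraph Δ c) zero
    (proj₂ ∘ sharpGraph-deg)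
    (trans (nbrSum-⊕-↑ˡ (K₂ Δ) (copies c (K₂ Δ)) (λ _ → 1) zero) (deg-K₂-hub Δ))

  sharpGraph-strongSupportCount : strongSupportCount (sharpGraph Δ c) ≡ 0
  sharpGraph-strongSupportCount =
    strongSupportCount≡0 (sharpGraph Δ c) (proj₁ ∘ sharpGraph-deg)

  sharpGraph-tight : 2 * (suc c * (2 + Δ) + strongSupportCount (sharpGraph Δ c))
                     ≡ weight (sharpGraph Δ c) (sharpCID Δ c) * (maxDeg (sharpGraph Δ c) + 2)
  sharpGraph-tight = begin
    2 * (suc c * (2 + Δ) + strongSupportCount (sharpGraph Δ c))
      ≡⟨ cong (λ s → 2 * (suc c * (2 + Δ) + s)) sharpGraph-strongSupportCount ⟩
    2 * (suc c * (2 + Δ) + 0)  ≡⟨ cong (2 *_) (+-identityʳ (suc c * (2 + Δ))) ⟩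
    2 * (suc c * (2 + Δ))      ≡⟨ sym (*-assoc 2 (suc c) (2 + Δ)) ⟩
    2 * suc c * (2 + Δ)        ≡⟨ cong₂ _*_ (*-comm 2 (suc c)) (+-comm 2 Δ) ⟩
    suc c * 2 * (Δ + 2)
      ≡⟨ cong₂ (λ w d → w * (d + 2)) (sym (sharpCID-weight Δ c)) (sym sharpGraph-maxDeg) ⟩
    weight (sharpGraph Δ c) (sharpCID Δ c) * (maxDeg (sharpGraph Δ c) + 2)
      ∎
    where open ≡-Reasoning

corollary7 :
    ((n : ℕ) (G : Graph n) (k : ℕ) → IsGammaCI G k →
      2 * (n + strongSupportCount G) ≤ k * (maxDeg G + 2))
    ×
    ((Δ : ℕ) → 2 ≤ Δ → (m : ℕ) →
      Σ ℕ (λ n → m ≤ n × Σ (Graph n) (λ G → maxDeg G ≡ Δ ×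
        Σ ℕ (λ k → IsGammaCI G k ×
          2 * (n + strongSupportCount G) ≡ k * (maxDeg G + 2)))))
corollary7 =
  (λ n G k → IsGammaCI⇒lowerBound G) ,
  λ Δ 2≤Δ m →
    suc m * (2 + Δ) , ≤-trans (n≤1+n m) (m≤m*n (suc m) (2 + Δ)) ,
    sharpGraph Δ m , sharpGraph-maxDeg 2≤Δ m ,
    weight (sharpGraph Δ m) (sharpCID Δ m) ,
    tight⇒IsGammaCI (sharpGraph Δ m) (sharpCID-IsCID Δ m) (sharpGraph-tight 2≤Δ m) ,
    sharpGraph-tight 2≤Δ m
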